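{- Let $A$ be a finite commutative unitary ring and let $x\in\{ -1_A,0_A,1_A\}$. There exists $k_x\in\mathbb{N}^*$ such that for every $n\ge k_x$ and every $(a_1,\dots,a_n)\in A^n$, there exist $1\le i\le n$ and $1\le j\le n-i+1$ with $K_i(a_j,\dots,a_{j+i-1})=x$.
   Context: For $i\ge1$ and $a_1,\dots,a_i\in A$, the continuant $K_i(a_1,\dots,a_i)$ is the determinant of the $i\times i$ tridiagonal matrix with diagonal $a_1,\dots,a_i$ and all sub- and super-diagonal entries equal to $1_A$. -}

module Defs where

open import Level using (Level)
open import Data.Nat using (ℕ; zero; suc)
import Data.Nat as N
open import Data.Nat.Properties using (+-monoʳ-<; ≤-trans; +-comm)
open import Data.Fin using (Fin; zero; suc; toℕ; fromℕ<; punchIn)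
open import Data.Fin.Properties using (toℕ<n)
open import Data.Product using (Σ; ∃; _×_)
open import Relation.Binary.PropositionalEquality using (_≡_)
open import Algebra.Bundles using (CommutativeRing)
import Relation.Nullary
import Data.Nat

module _ {c ℓ : Level} (R : CommutativeRing c ℓ) where
  open CommutativeRing R using (Carrier; _≈_; _+_; _*_; -_; 0#; 1#)

  IsFinite : Set (c Level.⊔ ℓ)
  IsFinite = Σ ℕ λ m → Σ (Fin m → Carrier) λ f → Σ (Carrier → Fin m) λ g →
               (∀ a → f (g a) ≈ a) × (∀ i → g (f i) ≡ i) ×
               (∀ a b → a ≈ b → g a ≡ g b)

  sumFin : (n : ℕ) → (Fin n → Carrier) → Carrier
  sumFin zero    f = 0#
  sumFin (suc n) f = f zero + sumFin n (λ k → f (suc k))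

  sign : ℕ → Carrier
  sign zero    = 1#
  sign (suc k) = - sign k

  det : (n : ℕ) → (Fin n → Fin n → Carrier) → Carrier
  det zero    M = 1#
  det (suc n) M =
    sumFin (suc n) (λ j → sign (toℕ j) * (M zero j *
      det n (λ r s → M (suc r) (punchIn j s))))

  tridiag : (n : ℕ) → (Fin n → Carrier) → Fin n → Fin n → Carrier
  tridiag n a r s with toℕ r | toℕ s
  ... | p | q with p N.≟ q
  ...   | Relation.Nullary.yes _ = a r
  ...   | Relation.Nullary.no _ with suc p N.≟ q | p N.≟ suc q
  ...     | Relation.Nullary.yes _ | _ = 1#
  ...     | Relation.Nullary.no _ | Relation.Nullary.yes _ = 1#
  ...     | Relation.Nullary.no _ | Relation.Nullary.no _ = 0#

  K : (i : ℕ) → (Fin i → Carrier) → Carrier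
  K i a = det i (tridiag i a)

  -- the window (a_{j+1}, …, a_{j+i}) of a : Fin n → A (0-based offset j),
  -- defined when j + i ≤ n
  window : {n : ℕ} → (Fin n → Carrier) → (i j : ℕ) → j N.+ i N.≤ n → Fin i → Carrier
  window a i j le t = a (fromℕ< (≤-trans (+-monoʳ-< j (toℕ<n t)) le))

-- The continuants obey K(a₁,…,aᵢ) = a₁ K(a₂,…,aᵢ) − K(a₃,…,aᵢ), so
-- (K(a₁,…,aᵢ), K(a₂,…,aᵢ)) = M(a₁)⋯M(aᵢ) e₁ for the invertible transfer
-- matrices M(a) = [[a, −1], [1, 0]] and e₁ = (1, 0).  A ring with m elements
-- has m² vectors, so among M(a₁)⋯M(aₜ) v, t = 0, …, m², two agree, and
-- cancelling the common prefix gives a window w of the sequence with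
-- M(w) v = v.  For v = e₁ this says K(w) = 1 and that w without its first
-- entry has continuant 0.  For v = e₂ = (0, 1) one has M(w) e₂ = −M(w′) e₁,
-- w′ being w without its last entry, so w′ without its first entry has
-- continuant −1.  Windows too short for this reading force 1 = 0, except
-- when w = (a, b): then K(w′) = a = 0 and K(w) = ab − 1 = −1.
module Submission where

open import Defs
open import Level using (Level)
open import Function using (_∘_)
open import Data.Nat as ℕ using (ℕ; zero; suc; _≤_; s≤s; z≤n)
open import Data.Nat.Properties using (+-suc; ≤-trans; <⇒≤; n≤1+n; n<1+n; +-monoʳ-≤; m≤n⇒∃[o]m+o≡n)
open import Data.Fin as Fin using (Fin; zero; suc; toℕ; fromℕ<; punchIn)
open import Data.Fin.Properties using (toℕ<n; toℕ-fromℕ<; pigeonhole; combine-injective)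
open import Data.Product using (Σ; ∃₂; _×_; _,_; proj₁; proj₂)
open import Data.Product.Relation.Binary.Pointwise.NonDependent using (×-setoid)
open import Data.Sum using (_⊎_; inj₁; inj₂)
open import Relation.Binary.Bundles using (Setoid)
open import Relation.Binary.PropositionalEquality as ≡ using (_≡_; refl)
open import Relation.Nullary using (¬_; yes; no)
open import Data.Empty using (⊥-elim)
open import Algebra.Bundles using (CommutativeRing)

module Continuants {c ℓ : Level} (R : CommutativeRing c ℓ) where
  open CommutativeRing R renaming (refl to ≈-refl; sym to ≈-sym; trans to ≈-trans) hiding (zero)
  open import Algebra.Properties.Ring ring
    using (-1*x≈-x; -0#≈0#; -‿distribʳ-*; -‿+-comm; -‿injective; +-cancelˡ; ⁻¹-selfInverse)
  open import Relation.Binary.Reasoning.Setoid setoid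

  x≈0⇒x*y≈0 : ∀ {x} y → x ≈ 0# → x * y ≈ 0#
  x≈0⇒x*y≈0 y x≈0 = ≈-trans (*-congʳ x≈0) (zeroˡ y)

  y≈0⇒x*y≈0 : ∀ x {y} → y ≈ 0# → x * y ≈ 0#
  y≈0⇒x*y≈0 x y≈0 = ≈-trans (*-congˡ y≈0) (zeroʳ x)

  1≈0⇒≈ : 1# ≈ 0# → ∀ y z → y ≈ z
  1≈0⇒≈ 1≈0 y z = begin
    y       ≈⟨ *-identityʳ y ⟨
    y * 1#  ≈⟨ y≈0⇒x*y≈0 y 1≈0 ⟩
    0#      ≈⟨ y≈0⇒x*y≈0 z 1≈0 ⟨
    z * 1#  ≈⟨ *-identityʳ z ⟩
    z       ∎

  -- The entries of tridiag, by structural recursion on the indices: shifting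
  -- both indices then reduces definitionally.
  bandEntry : ℕ → ℕ → Carrier → Carrier
  bandEntry zero          zero          d = d
  bandEntry zero          (suc zero)    d = 1#
  bandEntry zero          (suc (suc _)) d = 0#
  bandEntry (suc p)       (suc q)       d = bandEntry p q d
  bandEntry (suc zero)    zero          d = 1#
  bandEntry (suc (suc _)) zero          d = 0#

  tridiag≡bandEntry : ∀ n a (r s : Fin n) → tridiag R n a r s ≡ bandEntry (toℕ r) (toℕ s) (a r)
  tridiag≡bandEntry n a r s with toℕ r | toℕ s
  ... | p | q with p ℕ.≟ q
  ...   | yes refl = ≡.sym (diagonal p)
    where
    diagonal : ∀ p → bandEntry p p (a r) ≡ a r
    diagonal zero    = refl
    diagonal (suc p) = diagonal p
  ...   | no p≢q with suc p ℕ.≟ q | p ℕ.≟ suc q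
  ...     | yes refl | _ = ≡.sym (super p)
    where
    super : ∀ p → bandEntry p (suc p) (a r) ≡ 1#
    super zero    = refl
    super (suc p) = super p
  ...     | no _ | yes refl = ≡.sym (sub q)
    where
    sub : ∀ q → bandEntry (suc q) q (a r) ≡ 1#
    sub zero    = refl
    sub (suc q) = sub q
  ...     | no 1+p≢q | no p≢1+q = ≡.sym (off p q p≢q 1+p≢q p≢1+q)
    where
    off : ∀ p q → ¬ p ≡ q → ¬ suc p ≡ q → ¬ p ≡ suc q → bandEntry p q (a r) ≡ 0#
    off zero          zero          ne _ _ = ⊥-elim (ne refl)
    off zero          (suc zero)    _ ne _ = ⊥-elim (ne refl)
    off zero          (suc (suc q)) _ _ _  = refl
    off (suc zero)    zero          _ _ ne = ⊥-elim (ne refl)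
    off (suc (suc p)) zero          _ _ _  = refl
    off (suc p)       (suc q)       ne₁ ne₂ ne₃ =
      off p q (ne₁ ∘ ≡.cong ℕ.suc) (ne₂ ∘ ≡.cong ℕ.suc) (ne₃ ∘ ≡.cong ℕ.suc)

  tridiag-entry : ∀ {n} a (r s : Fin n) → tridiag R n a r s ≈ bandEntry (toℕ r) (toℕ s) (a r)
  tridiag-entry a r s = reflexive (tridiag≡bandEntry _ a r s)

  tridiag-suc : ∀ n a (r s : Fin n) → tridiag R (suc n) a (suc r) (suc s) ≈ tridiag R n (a ∘ Fin.suc) r s
  tridiag-suc n a r s = ≈-trans (tridiag-entry a (suc r) (suc s)) (≈-sym (tridiag-entry (a ∘ Fin.suc) r s))

  sumFin-cong : ∀ n {f g : Fin n → Carrier} → (∀ k → f k ≈ g k) → sumFin R n f ≈ sumFin R n g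
  sumFin-cong zero    f≈g = ≈-refl
  sumFin-cong (suc n) f≈g = +-cong (f≈g zero) (sumFin-cong n (f≈g ∘ Fin.suc))

  sumFin-zero : ∀ n {f : Fin n → Carrier} → (∀ k → f k ≈ 0#) → sumFin R n f ≈ 0#
  sumFin-zero zero    f≈0 = ≈-refl
  sumFin-zero (suc n) f≈0 = ≈-trans (+-cong (f≈0 zero) (sumFin-zero n (f≈0 ∘ Fin.suc))) (+-identityˡ 0#)

  minor : ∀ {n} → (Fin (suc n) → Fin (suc n) → Carrier) → Fin (suc n) → Fin n → Fin n → Carrier
  minor M j r s = M (suc r) (punchIn j s)

  cofactorTerm : ∀ {n} → (Fin (suc n) → Fin (suc n) → Carrier) → Fin (suc n) → Carrier
  cofactorTerm {n} M j = sign R (toℕ j) * (M zero j * det R n (minor M j))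

  det-cong : ∀ n {M N : Fin n → Fin n → Carrier} → (∀ r s → M r s ≈ N r s) → det R n M ≈ det R n N
  det-cong zero    M≈N = ≈-refl
  det-cong (suc n) {M} {N} M≈N = sumFin-cong (suc n) {cofactorTerm M} {cofactorTerm N} λ j →
    *-congˡ (*-cong (M≈N zero j) (det-cong n (λ r s → M≈N (suc r) (punchIn j s))))

  -- The other terms of the row expansion vanish: their minors again have a
  -- first column that is zero below the diagonal, with top entry M 1 0 ≈ 0.
  det-firstColumn : ∀ n (M : Fin (suc n) → Fin (suc n) → Carrier) → (∀ r → M (suc r) zero ≈ 0#) →
                    det R (suc n) M ≈ M zero zero * det R n (λ r s → M (suc r) (suc s))
  det-firstColumn zero    M col = ≈-trans (+-identityʳ _) (*-identityˡ _)
  det-firstColumn (suc n) M col = ≈-trans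
    (+-cong (*-identityˡ _) (sumFin-zero (suc n) {cofactorTerm M ∘ Fin.suc} λ k → y≈0⇒x*y≈0 _ (y≈0⇒x*y≈0 _
      (≈-trans (det-firstColumn n (minor M (suc k)) (col ∘ Fin.suc)) (x≈0⇒x*y≈0 _ (col zero))))))
    (+-identityʳ _)

  K-one : ∀ a → K R 1 a ≈ a zero
  K-one a = begin
    1# * (tridiag R 1 a zero zero * 1#) + 0#  ≈⟨ +-identityʳ _ ⟩
    1# * (tridiag R 1 a zero zero * 1#)       ≈⟨ *-identityˡ _ ⟩
    tridiag R 1 a zero zero * 1#              ≈⟨ *-identityʳ _ ⟩
    tridiag R 1 a zero zero                   ≈⟨ tridiag-entry a zero zero ⟩
    a zero                                    ∎

  K-recurrence : ∀ n a → K R (suc (suc n)) a ≈ a zero * K R (suc n) (a ∘ Fin.suc) - K R n (a ∘ Fin.suc ∘ Fin.suc)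
  K-recurrence n a = begin
    1# * (M zero zero * D₀) + (- 1# * (M zero (suc zero) * D₁) + rest)
      ≈⟨ +-cong (*-identityˡ _) (≈-trans (+-cong (-1*x≈-x _) rest≈0) (+-identityʳ _)) ⟩
    M zero zero * D₀ - M zero (suc zero) * D₁
      ≈⟨ +-cong (*-cong (tridiag-entry a zero zero) D₀≈K) (-‿cong M₀₁D₁≈K) ⟩
    a zero * K R (suc n) (a ∘ Fin.suc) - K R n (a ∘ Fin.suc ∘ Fin.suc)  ∎
    where
    M : Fin (suc (suc n)) → Fin (suc (suc n)) → Carrier
    M = tridiag R (suc (suc n)) a
    D₀ D₁ : Carrier
    D₀ = det R (suc n) (minor M zero)
    D₁ = det R (suc n) (minor M (suc zero))
    rest : Carrier
    rest = sumFin R n (cofactorTerm M ∘ Fin.suc ∘ Fin.suc)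
    rest≈0 : rest ≈ 0#
    rest≈0 = sumFin-zero n λ k → y≈0⇒x*y≈0 _ (x≈0⇒x*y≈0 _ (tridiag-entry a zero (suc (suc k))))
    D₀≈K : D₀ ≈ K R (suc n) (a ∘ Fin.suc)
    D₀≈K = det-cong (suc n) (tridiag-suc (suc n) a)
    M₀₁D₁≈K : M zero (suc zero) * D₁ ≈ K R n (a ∘ Fin.suc ∘ Fin.suc)
    M₀₁D₁≈K = begin
      M zero (suc zero) * D₁
        ≈⟨ *-cong (tridiag-entry a zero (suc zero))
                  (det-firstColumn n (minor M (suc zero)) (λ r → tridiag-entry a (suc (suc r)) zero)) ⟩
      1# * (M (suc zero) zero * det R n (λ r s → M (suc (suc r)) (suc (suc s))))
        ≈⟨ *-identityˡ _ ⟩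
      M (suc zero) zero * det R n (λ r s → M (suc (suc r)) (suc (suc s)))
        ≈⟨ *-cong (tridiag-entry a (suc zero) zero)
                  (det-cong n λ r s → ≈-trans (tridiag-suc (suc n) a (suc r) (suc s)) (tridiag-suc n (a ∘ Fin.suc) r s)) ⟩
      1# * K R n (a ∘ Fin.suc ∘ Fin.suc)
        ≈⟨ *-identityˡ _ ⟩
      K R n (a ∘ Fin.suc ∘ Fin.suc)  ∎

  continuant : (ℕ → Carrier) → ℕ → Carrier
  continuant s zero          = 1#
  continuant s (suc zero)    = s 0
  continuant s (suc (suc i)) = s 0 * continuant (s ∘ ℕ.suc) (suc i) - continuant (s ∘ ℕ.suc ∘ ℕ.suc) i

  K≈continuant : ∀ i (a : Fin i → Carrier) (s : ℕ → Carrier) → (∀ t → a t ≈ s (toℕ t)) →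
                 K R i a ≈ continuant s i
  K≈continuant zero          a s a≈s = ≈-refl
  K≈continuant (suc zero)    a s a≈s = ≈-trans (K-one a) (a≈s zero)
  K≈continuant (suc (suc i)) a s a≈s = ≈-trans (K-recurrence i a)
    (+-cong (*-cong (a≈s zero) (K≈continuant (suc i) (a ∘ Fin.suc) (s ∘ ℕ.suc) (a≈s ∘ Fin.suc)))
            (-‿cong (K≈continuant i (a ∘ Fin.suc ∘ Fin.suc) (s ∘ ℕ.suc ∘ ℕ.suc) (a≈s ∘ Fin.suc ∘ Fin.suc))))

  Pair : Set c
  Pair = Carrier × Carrier

  open Setoid (×-setoid setoid setoid)
    using () renaming (_≈_ to _≋_; refl to ≋-refl; trans to ≋-trans; reflexive to ≋-reflexive)

  e₁ e₂ : Pair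
  e₁ = 1# , 0#
  e₂ = 0# , 1#

  neg : Pair → Pair
  neg (p , q) = - p , - q

  transfer : Carrier → Pair → Pair
  transfer x (p , q) = x * p - q , p

  transfers : (ℕ → Carrier) → ℕ → Pair → Pair
  transfers s zero    v = v
  transfers s (suc i) v = transfer (s 0) (transfers (s ∘ ℕ.suc) i v)

  transfers-+ : ∀ s i j v → transfers s (i ℕ.+ j) v ≡ transfers s i (transfers (λ k → s (i ℕ.+ k)) j v)
  transfers-+ s zero    j v = refl
  transfers-+ s (suc i) j v = ≡.cong (transfer (s 0)) (transfers-+ (s ∘ ℕ.suc) i j v)

  transfers-suc : ∀ s i v → transfers s (suc i) v ≡ transfers s i (transfer (s i) v)
  transfers-suc s zero    v = refl
  transfers-suc s (suc i) v = ≡.cong (transfer (s 0)) (transfers-suc (s ∘ ℕ.suc) i v)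

  transfer-cong : ∀ x {u v} → u ≋ v → transfer x u ≋ transfer x v
  transfer-cong x (p≈p′ , q≈q′) = +-cong (*-congˡ p≈p′) (-‿cong q≈q′) , p≈p′

  transfers-cong : ∀ s i {u v} → u ≋ v → transfers s i u ≋ transfers s i v
  transfers-cong s zero    u≋v = u≋v
  transfers-cong s (suc i) u≋v = transfer-cong (s 0) (transfers-cong (s ∘ ℕ.suc) i u≋v)

  transfer-injective : ∀ x {u v} → transfer x u ≋ transfer x v → u ≋ v
  transfer-injective x {p , q} {p′ , q′} (eq₁ , p≈p′) = p≈p′ ,
    -‿injective (+-cancelˡ (x * p) (- q) (- q′) (≈-trans eq₁ (+-congʳ (*-congˡ (≈-sym p≈p′)))))

  transfers-injective : ∀ s i {u v} → transfers s i u ≋ transfers s i v → u ≋ v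
  transfers-injective s zero    eq = eq
  transfers-injective s (suc i) eq = transfers-injective (s ∘ ℕ.suc) i (transfer-injective (s 0) eq)

  transfer-neg : ∀ x v → transfer x (neg v) ≋ neg (transfer x v)
  transfer-neg x (p , q) = ≈-trans (+-congʳ (≈-sym (-‿distribʳ-* x p))) (-‿+-comm (x * p) (- q)) , ≈-refl

  transfers-neg : ∀ s i v → transfers s i (neg v) ≋ neg (transfers s i v)
  transfers-neg s zero    v = ≋-refl
  transfers-neg s (suc i) v =
    ≋-trans (transfer-cong (s 0) (transfers-neg (s ∘ ℕ.suc) i v)) (transfer-neg (s 0) _)

  transfers-e₁ : ∀ s i → proj₁ (transfers s i e₁) ≈ continuant s i
  transfers-e₁ s zero          = ≈-refl
  transfers-e₁ s (suc zero)    = ≈-trans (+-cong (*-identityʳ _) -0#≈0#) (+-identityʳ _)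
  transfers-e₁ s (suc (suc i)) =
    +-cong (*-congˡ (transfers-e₁ (s ∘ ℕ.suc) (suc i))) (-‿cong (transfers-e₁ (s ∘ ℕ.suc ∘ ℕ.suc) i))

  transfers-e₂ : ∀ s i → transfers s (suc i) e₂ ≋ neg (transfers s i e₁)
  transfers-e₂ s i = ≋-trans (≋-reflexive (transfers-suc s i e₂))
    (≋-trans (transfers-cong s i (≈-trans (+-congʳ (zeroʳ _)) (+-identityˡ _) , ≈-sym -0#≈0#))
             (transfers-neg s i e₁))

  pairs-pigeonhole : ∀ {m} (g : Carrier → Fin m) → (∀ {x y} → g x ≡ g y → x ≈ y) →
                     (v : Fin (suc (m ℕ.* m)) → Pair) → ∃₂ λ i j → i Fin.< j × v i ≋ v j
  pairs-pigeonhole g g-injective v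
    with i , j , i<j , code≡ ← pigeonhole (n<1+n _) (λ t → Fin.combine (g (proj₁ (v t))) (g (proj₂ (v t))))
    with eq₁ , eq₂ ← combine-injective _ _ _ _ code≡
    = i , j , i<j , g-injective eq₁ , g-injective eq₂

  -- Junk value 0# past the end; only windows inside the sequence are read.
  extend : ∀ {n} → (Fin n → Carrier) → ℕ → Carrier
  extend {zero}  a k       = 0#
  extend {suc n} a zero    = a zero
  extend {suc n} a (suc k) = extend (a ∘ Fin.suc) k

  extend-toℕ : ∀ {n} (a : Fin n → Carrier) t → extend a (toℕ t) ≡ a t
  extend-toℕ a zero    = refl
  extend-toℕ a (suc t) = extend-toℕ (a ∘ Fin.suc) t

  suffix : ∀ {n} → (Fin n → Carrier) → ℕ → ℕ → Carrier
  suffix a j k = extend a (j ℕ.+ k)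

  K-window : ∀ {n} (a : Fin n → Carrier) i j (le : j ℕ.+ i ≤ n) (s : ℕ → Carrier) →
             (∀ k → s k ≡ suffix a j k) → K R i (window R a i j le) ≈ continuant s i
  K-window a i j le s s≡ = K≈continuant i _ s λ t → begin
    a (fromℕ< _)              ≡⟨ extend-toℕ a _ ⟨
    extend a (toℕ (fromℕ< _)) ≡⟨ ≡.cong (extend a) (toℕ-fromℕ< _) ⟩
    suffix a j (toℕ t)        ≡⟨ s≡ (toℕ t) ⟨
    s (toℕ t)                 ∎

  HasWindowContinuant : ∀ {n} → (Fin n → Carrier) → Carrier → Set ℓ
  HasWindowContinuant {n} a x = ∃₂ λ i j → Σ (j ℕ.+ i ≤ n) λ le → 1 ≤ i × K R i (window R a i j le) ≈ x

  FixedByWindow : ∀ {n} → (Fin n → Carrier) → Pair → Set ℓ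
  FixedByWindow {n} a v = ∃₂ λ lo d → lo ℕ.+ suc d ≤ n × v ≋ transfers (suffix a lo) (suc d) v

  fixedByWindow : ∀ {m} (g : Carrier → Fin m) → (∀ {x y} → g x ≡ g y → x ≈ y) →
                  ∀ {n} → suc (m ℕ.* m) ≤ n → (a : Fin n → Carrier) (v : Pair) → FixedByWindow a v
  fixedByWindow g g-injective {n} m*m<n a v
    with i , j , i<j , orbit-i≋orbit-j ← pairs-pigeonhole g g-injective (λ t → transfers (extend a) (toℕ t) v)
    with o , 1+i+o≡j ← m≤n⇒∃[o]m+o≡n i<j
    = toℕ i , o , i+1+o≤n , transfers-injective (extend a) (toℕ i)
        (≋-trans orbit-i≋orbit-j (≋-reflexive (≡.trans (≡.cong (λ t → transfers (extend a) t v) (≡.sym i+1+o≡j))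
                                                        (transfers-+ (extend a) (toℕ i) (suc o) v))))
    where
    i+1+o≡j : toℕ i ℕ.+ suc o ≡ toℕ j
    i+1+o≡j = ≡.trans (+-suc (toℕ i) o) 1+i+o≡j
    i+1+o≤n : toℕ i ℕ.+ suc o ≤ n
    i+1+o≤n = ≡.subst (_≤ n) (≡.sym i+1+o≡j) (<⇒≤ (≤-trans (toℕ<n j) m*m<n))

  module _ {n} (a : Fin n → Carrier) {x : Carrier} where

    window-continuant : ∀ i j (le : j ℕ.+ suc i ≤ n) (s : ℕ → Carrier) → (∀ k → s k ≡ suffix a j k) →
                        continuant s (suc i) ≈ x → HasWindowContinuant a x
    window-continuant i j le s s≡ s≈x = suc i , j , le , s≤s z≤n , ≈-trans (K-window a (suc i) j le s s≡) s≈x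

    window-continuant-suc : ∀ i lo → lo ℕ.+ suc (suc i) ≤ n →
                            continuant (suffix a lo ∘ ℕ.suc) (suc i) ≈ x → HasWindowContinuant a x
    window-continuant-suc i lo le = window-continuant i (suc lo) (≡.subst (_≤ n) (+-suc lo (suc i)) le) _
      (λ k → ≡.cong (extend a) (+-suc lo k))

    window-trivial : ∀ lo → lo ℕ.+ 1 ≤ n → 1# ≈ 0# → HasWindowContinuant a x
    window-trivial lo le 1≈0 = window-continuant 0 lo le (suffix a lo) (λ _ → refl) (1≈0⇒≈ 1≈0 _ _)

    window-one : x ≈ 1# → FixedByWindow a e₁ → HasWindowContinuant a x
    window-one x≈1 (lo , d , le , e₁≋ , _) = window-continuant d lo le (suffix a lo) (λ _ → refl)
      (≈-trans (≈-sym (transfers-e₁ (suffix a lo) (suc d))) (≈-trans (≈-sym e₁≋) (≈-sym x≈1)))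

    window-zero : x ≈ 0# → FixedByWindow a e₁ → HasWindowContinuant a x
    window-zero x≈0 (lo , zero  , le , _ , 0≈1) = window-trivial lo le (≈-sym 0≈1)
    window-zero x≈0 (lo , suc d , le , _ , 0≈K) = window-continuant-suc d lo le
      (≈-trans (≈-sym (transfers-e₁ (suffix a lo ∘ ℕ.suc) (suc d))) (≈-trans (≈-sym 0≈K) (≈-sym x≈0)))

    window-minusOne : x ≈ - 1# → FixedByWindow a e₂ → HasWindowContinuant a x
    window-minusOne x≈-1 (lo , zero , le , e₂≋)
      with _ , 1≈-0 ← ≋-trans e₂≋ (transfers-e₂ (suffix a lo) 0)
      = window-trivial lo le (≈-trans 1≈-0 -0#≈0#)
    window-minusOne x≈-1 (lo , suc zero , le , e₂≋)
      with 0≈-a₀ , _ ← ≋-trans e₂≋ (transfers-e₂ (suffix a lo) 1)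
      = window-continuant 1 lo le (suffix a lo) (λ _ → refl) (begin
      suffix a lo 0 * suffix a lo 1 - 1#  ≈⟨ +-congʳ (x≈0⇒x*y≈0 _ a₀≈0) ⟩
      0# - 1#                             ≈⟨ +-identityˡ _ ⟩
      - 1#                                ≈⟨ x≈-1 ⟨
      x                                   ∎)
      where
      a₀≈0 : suffix a lo 0 ≈ 0#
      a₀≈0 = ≈-trans (≈-sym (transfers-e₁ (suffix a lo) 1))
               (≈-trans (≈-sym (⁻¹-selfInverse (≈-sym 0≈-a₀))) -0#≈0#)
    window-minusOne x≈-1 (lo , suc (suc i) , le , e₂≋)
      with _ , 1≈-K ← ≋-trans e₂≋ (transfers-e₂ (suffix a lo) (suc (suc i)))
      = window-continuant-suc i lo
      (≤-trans (+-monoʳ-≤ lo (n≤1+n _)) le)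
      (≈-trans (≈-sym (transfers-e₁ (suffix a lo ∘ ℕ.suc) (suc i)))
               (≈-trans (≈-sym (⁻¹-selfInverse (≈-sym 1≈-K))) (≈-sym x≈-1)))

open import Data.Nat using (_+_; _*_)

proposition3p1 : {c ℓ : Level} (R : CommutativeRing c ℓ) → IsFinite R →
    (x : CommutativeRing.Carrier R) →
    (CommutativeRing._≈_ R x (CommutativeRing.-_ R (CommutativeRing.1# R))
      ⊎ CommutativeRing._≈_ R x (CommutativeRing.0# R)
      ⊎ CommutativeRing._≈_ R x (CommutativeRing.1# R)) →
    Σ ℕ λ k → (1 ≤ k) × ((n : ℕ) → k ≤ n → (a : Fin n → CommutativeRing.Carrier R) →
      Σ ℕ λ i → Σ ℕ λ j → Σ (j + i ≤ n) λ le →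
        (1 ≤ i) × CommutativeRing._≈_ R (K R i (window R a i j le)) x)
proposition3p1 R (m , f , g , f∘g≈id , _) x x∈±1,0 = suc (m * m) , s≤s z≤n , λ n m*m<n a →
  windowFor x∈±1,0 a (fixedByWindow g g-injective m*m<n a)
  where
  open Continuants R
  open CommutativeRing R using (Carrier; _≈_; -_; 0#; 1#; sym; trans; reflexive)
  g-injective : ∀ {y z} → g y ≡ g z → y ≈ z
  g-injective {y} {z} gy≡gz = trans (sym (f∘g≈id y)) (trans (reflexive (≡.cong f gy≡gz)) (f∘g≈id z))
  windowFor : ∀ {n} → x ≈ - 1# ⊎ x ≈ 0# ⊎ x ≈ 1# → (a : Fin n → Carrier) →
              (∀ v → FixedByWindow a v) → HasWindowContinuant a x
  windowFor (inj₁ x≈-1)       a fixed = window-minusOne a x≈-1 (fixed e₂)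
  windowFor (inj₂ (inj₁ x≈0)) a fixed = window-zero a x≈0 (fixed e₁)
  windowFor (inj₂ (inj₂ x≈1)) a fixed = window-one a x≈1 (fixed e₁)
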